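{- For every integer $k\geq 0$ there are infinitely many $n$ such that every nondeterministic OBDD on $n$ variables computing the partial function $\mathtt{PartialMOD^k_n}$ has width at least $2^{k+1}$.
   Context: For $\nu\in\{0,1\}^n$ let $\#_1(\nu)$ be the number of ones in $\nu$. The partial function $\mathtt{PartialMOD^k_n}$ on $\{0,1\}^n$ is defined by $\mathtt{PartialMOD^k_n}(\nu)=1$ if $\#_1(\nu)\equiv 0 \pmod{2^{k+1}}$, $\mathtt{PartialMOD^k_n}(\nu)=0$ if $\#_1(\nu)\equiv 2^k \pmod{2^{k+1}}$, and undefined otherwise. A nondeterministic OBDD (NOBDD) on variables $x_1,\dots,x_n$ with order $\pi$ (a permutation of $\{1,\dots,n\}$) is a leveled directed acyclic graph with levels $0,\dots,n$, a single source node at level $0$, where each node at level $j-1$ ($1\le j\le n$) has any number of outgoing edges, each labelled $0$ or $1$, going to nodes at level $j$; nodes at level $n$ are marked accepting or rejecting. A computation path on input $\nu$ starts at the source and at step $j$ follows some edge labelled $\nu_{\pi(j)}$; $\nu$ is accepted iff some computation path on $\nu$ ends at an accepting node. The width is the maximum number of nodes in a level. It computes a partial function $f$ if it accepts every $\nu$ with $f(\nu)=1$ and rejects every $\nu$ with $f(\nu)=0$. -}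

module Defs where

open import Data.Nat using (ℕ; zero; suc; _+_; _^_; _≤_; _%_)
open import Data.Nat.Properties using (m^n≢0)
open import Data.Bool using (Bool; true; false; if_then_else_)
open import Data.Fin using (Fin; zero; suc; inject₁; fromℕ)
open import Data.Fin.Permutation using (Permutation′; _⟨$⟩ʳ_)
open import Data.Maybe using (Maybe; just; nothing)
open import Data.Product using (Σ; ∃; _×_)
open import Relation.Binary.PropositionalEquality using (_≡_)
open import Relation.Nullary using (¬_)
open import Data.Nat using (_≟_)
open import Relation.Nullary.Decidable using (⌊_⌋)

Input : ℕ → Set
Input n = Fin n → Bool

ones : {n : ℕ} → Input n → ℕ
ones {zero}  ν = 0
ones {suc n} ν = (if ν zero then 1 else 0) + ones (λ i → ν (suc i))

-- Partial Boolean functions: nothing = undefined.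
PartialFun : ℕ → Set
PartialFun n = Input n → Maybe Bool

mod2^k+1 : ℕ → ℕ → ℕ
mod2^k+1 k m = _%_ m (2 ^ suc k) {{m^n≢0 2 (suc k)}}

PartialMOD : (k n : ℕ) → PartialFun n
PartialMOD k n ν =
  if ⌊ mod2^k+1 k (ones ν) ≟ 0 ⌋ then just true
  else if ⌊ mod2^k+1 k (ones ν) ≟ 2 ^ k ⌋ then just false
  else nothing

-- Levels are indexed by Fin (suc n) (levels 0..n); level l has size l nodes,
-- given by Fin (size l).
-- Step j (j : Fin n, i.e. the (j+1)-th step) goes from level inject₁ j to
-- level suc j and reads variable π(j); edge j u b v ≡ true means there is an
-- edge labelled b from node u at level j to node v at level j+1.
record NOBDD (n : ℕ) : Set where
  field
    order  : Permutation′ n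
    size   : Fin (suc n) → ℕ
    source : size zero ≡ 1
    edge   : (j : Fin n) → Fin (size (inject₁ j)) → Bool → Fin (size (suc j)) → Bool
    accepting : Fin (size (fromℕ n)) → Bool

  -- A computation path on ν: a choice of one node per level, starting at the
  -- (unique) source, consecutive nodes joined by an edge labelled ν_{π(j)}.
  IsPath : Input n → ((l : Fin (suc n)) → Fin (size l)) → Set
  IsPath ν p = (j : Fin n) → edge j (p (inject₁ j)) (ν (order ⟨$⟩ʳ j)) (p (suc j)) ≡ true

  Accepts : Input n → Set
  Accepts ν = Σ ((l : Fin (suc n)) → Fin (size l)) λ p → IsPath ν p × accepting (p (fromℕ n)) ≡ true

  WidthAtLeast : ℕ → Set
  WidthAtLeast w = ∃ λ (l : Fin (suc n)) → w ≤ size l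

open NOBDD public

Computes : {n : ℕ} → NOBDD n → PartialFun n → Set
Computes B f = ∀ ν → (f ν ≡ just true → Accepts B ν) × (f ν ≡ just false → ¬ Accepts B ν)

-- Suppose every level of B has at most D = 2^(k+1) − 1 nodes. Embedding all levels into Fin D turns B into a
-- nondeterministic automaton whose transitions depend on the time. Colour a pair of times i < j by the relation on
-- states realised by reading a 1 at time i followed by 0s up to time j, together with the set of states from which a
-- 1 at time i followed by 0s up to time n is accepted. For n large, Ramsey's theorem gives times x₀ < … < x_L whose
-- consecutive pairs all have the same colour, so an input with ones exactly at x₀, …, x_c is accepted iff a chain of
-- c steps of one fixed relation on Fin D links an initial state to an accepting one. A chain of length ≥ D contains a
-- cycle of some length 1 ≤ ℓ ≤ D < 2^(k+1), and repeating it a suitable number of times adds 2^k ones modulo 2^(k+1).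
-- Starting from the accepted input with 2^(k+1) ones this gives an accepted input B has to reject.
module Submission where

open import Defs
open import Level using (Level; _⊔_)
import Algebra.Properties.CommutativeMonoid.Sum as Sum
open import Data.Bool as Bool using (Bool; true; false; T; _∨_; _∧_; if_then_else_)
open import Data.Bool.Properties using (∨-zeroʳ; ∧-zeroʳ)
open import Data.Fin as Fin using (Fin; zero; suc; toℕ; inject₁; inject≤; fromℕ)
import Data.Fin.Properties as Fin
open import Data.Fin.Induction using (<-weakInduction)
open import Data.Fin.Permutation using (Permutation′; _⟨$⟩ʳ_; _⟨$⟩ˡ_; inverseˡ)
open import Data.List using (List; []; _∷_; length; filter; map; cartesianProduct; upTo)
open import Data.List.Properties using (length-upTo)
open import Data.List.Membership.Propositional using (_∈_)
open import Data.List.Membership.Propositional.Properties using (∈-map⁺; ∈-cartesianProduct⁺)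
open import Data.List.Relation.Binary.Sublist.Propositional.Properties using (filter⁺; filter-⊆; length-mono-≤)
open import Data.List.Relation.Unary.Any using (here; there)
open import Data.List.Relation.Unary.All as All using (All; []; _∷_)
import Data.List.Relation.Unary.All.Properties as All
open import Data.List.Relation.Unary.AllPairs using (AllPairs; []; _∷_)
import Data.List.Relation.Unary.AllPairs.Properties as AllPairs
open import Data.Maybe using (just)
open import Data.Nat.Base using (ℕ; zero; suc; pred; _+_; _*_; _∸_; _^_; _≤_; _<_; z≤n; s≤s; ≢-nonZero⁻¹)
open import Data.Nat.Properties
open import Data.Nat.DivMod using (m*n%n≡0; [m+kn]%n≡m%n; m<n⇒m%n≡m)
open import Data.Nat.Tactic.RingSolver using (solve-∀)
open import Data.Product using (∃; ∃₂; _×_; _,_; proj₁; proj₂; map₂; uncurry)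
import Data.Product.Properties as Product
open import Data.Sum using (_⊎_; inj₁; inj₂)
open import Data.Vec as Vec using (Vec; []; _∷_; tabulate; lookup)
import Data.Vec.Properties as Vec
open import Function using (_∘_; _∘′_; id)
open import Function.Bundles using (_⇔_; mk⇔; Equivalence)
open import Relation.Binary using (DecidableEquality; tri<; tri≈; tri>)
open import Relation.Binary.PropositionalEquality
open import Relation.Nullary using (¬_; Dec; yes; no; ¬?; contradiction)
open import Relation.Nullary.Decidable as Dec
  using (does; ⌊_⌋; isYes≗does; dec-true; dec-false; toWitness; fromWitness; _×-dec_; _⊎-dec_)

open Equivalence using (to; from)
open Sum +-0-commutativeMonoid using (sum; sum-permute; sum-cong-≗)

private variable
  a r : Level
  A : Set a
  m n : ℕ

data EvenOrOdd : ℕ → Set where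
  even : ∀ j → EvenOrOdd (j + j)
  odd  : ∀ j → EvenOrOdd (suc (j + j))

even-or-odd : ∀ n → EvenOrOdd n
even-or-odd zero = even 0
even-or-odd (suc n) with even-or-odd n
... | even j = odd j
... | odd j  = subst EvenOrOdd (cong suc (+-suc j j)) (even (suc j))

-- For odd ℓ, M = 2^k itself works; for even ℓ = j + j, the M found for j and k − 1 does.
multiple≡2^k : ∀ k {ℓ} → 0 < ℓ → ℓ < 2 ^ suc k → ∃₂ λ M q → M ≤ 2 ^ suc k × M * ℓ ≡ 2 ^ k + q * 2 ^ suc k
multiple≡2^k zero {suc zero}    _ _                = 1 , 0 , s≤s z≤n , refl
multiple≡2^k zero {suc (suc _)} _ (s≤s (s≤s ()))
multiple≡2^k (suc k) {ℓ} 0<ℓ ℓ<K with even-or-odd ℓ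
... | odd j  = 2 ^ suc k , j , m≤m+n _ _ , odd-case (2 ^ suc k) j
  where
  odd-case : ∀ P j → P * suc (j + j) ≡ P + j * (2 * P)
  odd-case = solve-∀
... | even j with multiple≡2^k k (positive j 0<ℓ) j<K
  where
  positive : ∀ j → 0 < j + j → 0 < j
  positive (suc _) _ = s≤s z≤n
  j<K : j < 2 ^ suc k
  j<K = *-cancelˡ-< 2 j _ (subst (_< 2 * 2 ^ suc k) (cong (j +_) (sym (+-identityʳ j))) ℓ<K)
...   | M , q , M≤ , Mj≡ = M , q , ≤-trans M≤ (m≤m+n _ _) , (begin
  M * (j + j)                            ≡⟨ *-distribˡ-+ M j j ⟩
  M * j + M * j                          ≡⟨ cong₂ _+_ Mj≡ Mj≡ ⟩
  (h + q * (2 * h)) + (h + q * (2 * h))  ≡⟨ even-case h q ⟩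
  2 * h + q * (2 * (2 * h))              ∎)
  where
  open ≡-Reasoning
  h = 2 ^ k
  even-case : ∀ h q → (h + q * (2 * h)) + (h + q * (2 * h)) ≡ 2 * h + q * (2 * (2 * h))
  even-case = solve-∀

data Chain {A : Set a} (R : A → A → Set r) : ℕ → A → A → Set (a ⊔ r) where
  []  : ∀ {x} → Chain R 0 x x
  _∷_ : ∀ {n x y z} → R x y → Chain R n y z → Chain R (suc n) x z

module _ {R : A → A → Set r} where

  infixr 5 _++_

  _++_ : ∀ {x y z} → Chain R m x y → Chain R n y z → Chain R (m + n) x z
  []       ++ ys = ys
  (r ∷ xs) ++ ys = r ∷ (xs ++ ys)

  _∷ʳ_ : ∀ {x y z} → Chain R n x y → R y z → Chain R (suc n) x z
  []       ∷ʳ s = s ∷ []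
  (r ∷ xs) ∷ʳ s = r ∷ (xs ∷ʳ s)

  unsnoc : ∀ {x z} → Chain R (suc n) x z → ∃ λ y → Chain R n x y × R y z
  unsnoc (r ∷ [])         = _ , [] , r
  unsnoc (r ∷ xs@(_ ∷ _)) with y , ys , s ← unsnoc xs = y , r ∷ ys , s

  iterate : ∀ M {x} → Chain R n x x → Chain R (M * n) x x
  iterate zero    xs = []
  iterate (suc M) xs = xs ++ iterate M xs

  -- visit xs i is the i-th element of xs (its last one when i ≥ n).
  visit : ∀ {x y} → Chain R n x y → ℕ → A
  visit {x = x} []       _       = x
  visit {x = x} (r ∷ xs) zero    = x
  visit         (r ∷ xs) (suc i) = visit xs i

  cut : ∀ {i x y} → i ≤ n → (xs : Chain R n x y) → Chain R i x (visit xs i) × Chain R (n ∸ i) (visit xs i) y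
  cut z≤n       []       = [] , []
  cut z≤n       (r ∷ xs) = [] , r ∷ xs
  cut (s≤s i≤n) (r ∷ xs) with ys , zs ← cut i≤n xs = r ∷ ys , zs

  cut₂ : ∀ {i j x y} → i ≤ j → j ≤ n → (xs : Chain R n x y) →
         Chain R i x (visit xs i) × Chain R (j ∸ i) (visit xs i) (visit xs j) × Chain R (n ∸ j) (visit xs j) y
  cut₂ z≤n       j≤n       []       = [] , cut j≤n []
  cut₂ z≤n       j≤n       (r ∷ xs) = [] , cut j≤n (r ∷ xs)
  cut₂ (s≤s i≤j) (s≤s j≤n) (r ∷ xs) with ys , zs , ws ← cut₂ i≤j j≤n xs = r ∷ ys , zs , ws

private
  pumped-length : ∀ M {i j n} → i ≤ j → j ≤ n → i + ((j ∸ i) + M * (j ∸ i) + (n ∸ j)) ≡ n + M * (j ∸ i)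
  pumped-length M {i} {j} {n} i≤j j≤n = begin
    i + (ℓ + M * ℓ + (n ∸ j))  ≡⟨ shuffle i ℓ (M * ℓ) (n ∸ j) ⟩
    (i + ℓ) + (n ∸ j) + M * ℓ  ≡⟨ cong (λ k → k + (n ∸ j) + M * ℓ) (m+[n∸m]≡n i≤j) ⟩
    j + (n ∸ j) + M * ℓ        ≡⟨ cong (_+ M * ℓ) (m+[n∸m]≡n j≤n) ⟩
    n + M * ℓ                  ∎
    where
    open ≡-Reasoning
    ℓ = j ∸ i
    shuffle : ∀ a b c d → a + (b + c + d) ≡ a + b + d + c
    shuffle = solve-∀

-- Two of the first D + 1 states of the chain coincide, and the loop between them can be repeated.
pump : ∀ {D} {R : Fin D → Fin D → Set r} {x y} → D ≤ n → Chain R n x y →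
       ∃ λ ℓ → 0 < ℓ × ℓ ≤ D × ∀ M → Chain R (n + M * ℓ) x y
pump {n = n} {D} {R} {x} {y} D≤n xs
  with i , j , i<j , same ← Fin.pigeonhole (n<1+n D) (λ i → visit xs (toℕ i))
  = toℕ j ∸ toℕ i , m<n⇒0<n∸m i<j , ≤-trans (m∸n≤m (toℕ j) (toℕ i)) j≤D , pumped
  where
  j≤D : toℕ j ≤ D
  j≤D = Fin.toℕ≤pred[n] j
  pumped : ∀ M → Chain R (n + M * (toℕ j ∸ toℕ i)) x y
  pumped M with pre , loop , post ← cut₂ (<⇒≤ i<j) (≤-trans j≤D D≤n) xs =
    subst (λ m → Chain R m x y) (pumped-length M (<⇒≤ i<j) (≤-trans j≤D D≤n))
      (pre ++ iterate (suc M) (subst (Chain R _ _) (sym same) loop) ++ subst (λ z → Chain R _ z y) (sym same) post)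

nth : A → List A → ℕ → A
nth d []       _       = d
nth d (x ∷ xs) zero    = x
nth d (x ∷ xs) (suc i) = nth d xs i

All-nth : ∀ {P : A → Set r} {d xs i} → All P xs → i < length xs → P (nth d xs i)
All-nth {i = zero}  (px ∷ _)  _         = px
All-nth {i = suc i} (_ ∷ pxs) (s≤s i<n) = All-nth pxs i<n

AllPairs-nth : ∀ {R : A → A → Set r} {d xs i} → AllPairs R xs → suc i < length xs → R (nth d xs i) (nth d xs (suc i))
AllPairs-nth {i = zero}  ((r ∷ _) ∷ _) _         = r
AllPairs-nth {i = zero}  ([] ∷ _)      (s≤s ())
AllPairs-nth {i = suc i} (_ ∷ rs)      (s≤s i<n) = AllPairs-nth rs i<n

module Ramsey {C : Set} (_≟_ : DecidableEquality C) (colours : List C) (complete : ∀ c → c ∈ colours) where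

  module _ {X : Set} (f : X → C) where

    class : C → List X → List X
    class c = filter (λ x → f x ≟ c)

    others : C → List X → List X
    others c = filter (λ x → ¬? (f x ≟ c))

    length-class+others : ∀ c xs → length (class c xs) + length (others c xs) ≡ length xs
    length-class+others c []       = refl
    length-class+others c (x ∷ xs) with does (f x ≟ c)
    ... | true  = cong suc (length-class+others c xs)
    ... | false = trans (+-suc _ _) (cong suc (length-class+others c xs))

    pigeonhole-cover : ∀ m cs xs → All (λ x → f x ∈ cs) xs → length cs * m < length xs → ∃ λ c → m < length (class c xs)
    pigeonhole-cover m []       (x ∷ xs) (() ∷ _) _
    pigeonhole-cover m (c ∷ cs) xs covered big with m <? length (class c xs)
    ... | yes m<c = c , m<c
    ... | no  m≮c = map₂ (λ m<c′ → <-≤-trans m<c′ shrinks) (pigeonhole-cover m cs (others c xs) covered′ big′)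
      where
      shrinks : ∀ {c′} → length (class c′ (others c xs)) ≤ length (class c′ xs)
      shrinks = length-mono-≤ (filter⁺ _ _ (λ { refl → id }) (filter-⊆ _ xs))
      covered′ : All (λ x → f x ∈ cs) (others c xs)
      covered′ = All.map (λ { (x≢c , here x≡c) → contradiction x≡c x≢c ; (_ , there x∈cs) → x∈cs })
                         (All.zip (All.all-filter (λ x → ¬? (f x ≟ c)) xs , All.filter⁺ (λ x → ¬? (f x ≟ c)) covered))
      big′ : length cs * m < length (others c xs)
      big′ = +-cancelˡ-< m _ _ (begin-strict
        m + length cs * m                           <⟨ big ⟩
        length xs                                   ≡⟨ length-class+others c xs ⟨
        length (class c xs) + length (others c xs)  ≤⟨ +-monoˡ-≤ _ (≮⇒≥ m≮c) ⟩
        m + length (others c xs)                    ∎)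
        where open ≤-Reasoning

    pigeonhole : ∀ m xs → length colours * m < length xs → ∃ λ c → m < length (class c xs)
    pigeonhole m xs = pigeonhole-cover m colours xs (All.tabulate (λ {x} _ → complete (f x)))

  bound : ℕ → ℕ
  bound zero    = 0
  bound (suc f) = suc (length colours * bound f)

  module _ (col : ℕ → ℕ → C) where

    Labelled : ℕ × C → ℕ × C → Set
    Labelled (y , c) (z , _) = y < z × col y z ≡ c

    -- The recursive call keeps only the points that y sees in its most frequent colour c.
    greedy : ∀ {P : ℕ → Set} f xs → AllPairs _<_ xs → All P xs → bound f < length xs →
             ∃ λ ys → length ys ≡ f × AllPairs Labelled ys × All (P ∘ proj₁) ys
    greedy zero xs _ _ _ = [] , refl , [] , []
    greedy {P} (suc f) (y ∷ rest) (y<rest ∷ sorted) (Py ∷ Prest) (s≤s big)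
      with c , bigger ← pigeonhole (col y) (bound f) rest big
      with ys , len , labelled , Pys ← greedy {λ z → P z × Labelled (y , c) (z , c)} f (class (col y) c rest)
                                        (AllPairs.filter⁺ _ sorted)
                                        (All.zip (All.filter⁺ _ Prest , All.zip (All.filter⁺ _ y<rest , All.all-filter _ rest)))
                                        bigger
      = (y , c) ∷ ys , cong suc len , proj₂ (All.unzip Pys) ∷ labelled , Py ∷ proj₁ (All.unzip Pys)

    monochromatic-path : ∀ L n → bound (suc (length colours * L)) < n →
      ∃₂ λ (x : ℕ → ℕ) E → (∀ a → a < L → x a < x (suc a) × col (x a) (x (suc a)) ≡ E) × x L < n
    monochromatic-path L n big
      with ys , len , labelled , below-n ← greedy {_< n} (suc (length colours * L)) (upTo n)
                                             (AllPairs.applyUpTo⁺₁ id n (λ i<j _ → i<j))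
                                             (All.applyUpTo⁺₁ id n id)
                                             (subst (bound (suc (length colours * L)) <_) (sym (length-upTo n)) big)
      with E , long ← pigeonhole proj₂ L ys (subst (length colours * L <_) (sym len) ≤-refl)
      = x , E , path , All-nth (All.filter⁺ _ below-n) long
      where
      zs = class proj₂ E ys
      x : ℕ → ℕ
      x a = proj₁ (nth (0 , E) zs a)
      path : ∀ a → a < L → x a < x (suc a) × col (x a) (x (suc a)) ≡ E
      path a a<L with x<x′ , coloured ← AllPairs-nth (AllPairs.filter⁺ _ labelled) (<-≤-trans (s≤s a<L) long)
        = x<x′ , trans coloured (All-nth (All.all-filter _ ys) (<-trans a<L long))

_≡[_,_⟩_ : (ℕ → Bool) → ℕ → ℕ → (ℕ → Bool) → Set
w ≡[ i , j ⟩ w′ = ∀ t → i ≤ t → t < j → w t ≡ w′ t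

≡[,⟩-sym : ∀ {w w′ i j} → w ≡[ i , j ⟩ w′ → w′ ≡[ i , j ⟩ w
≡[,⟩-sym same t i≤t t<j = sym (same t i≤t t<j)

module Walks {D : ℕ} (Step : ℕ → Bool → Fin D → Fin D → Set) where

  infixl 5 _▷_

  -- Walk w i u j v: from state u at time i to state v at time j, reading w i, …, w (j − 1).
  data Walk (w : ℕ → Bool) (i : ℕ) (u : Fin D) : ℕ → Fin D → Set where
    []  : Walk w i u i u
    _▷_ : ∀ {j y v} → Walk w i u j y → Step j (w j) y v → Walk w i u (suc j) v

  module _ {w : ℕ → Bool} where

    infixl 5 _▷▷_

    Walk-≤ : ∀ {i j u v} → Walk w i u j v → i ≤ j
    Walk-≤ []      = ≤-refl
    Walk-≤ (W ▷ _) = m≤n⇒m≤1+n (Walk-≤ W)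

    _▷▷_ : ∀ {i j k u v y} → Walk w i u k y → Walk w k y j v → Walk w i u j v
    W ▷▷ []      = W
    W ▷▷ (V ▷ s) = (W ▷▷ V) ▷ s

    split : ∀ {i j k u v} → i ≤ k → k ≤ j → Walk w i u j v → ∃ λ y → Walk w i u k y × Walk w k y j v
    split i≤k k≤i [] with refl ← ≤-antisym i≤k k≤i = _ , [] , []
    split i≤k k≤j (W ▷ s) with m≤n⇒m<n∨m≡n k≤j
    ... | inj₂ refl      = _ , W ▷ s , []
    ... | inj₁ (s≤s k≤j) with y , W₁ , W₂ ← split i≤k k≤j W = y , W₁ , W₂ ▷ s

    -- The state at time t (the first state before time i, the last one after time j).
    state : ∀ {i j u v} → Walk w i u j v → ℕ → Fin D
    state {u = u} []            t = u
    state {v = v} (_▷_ {j} W _) t with t ≤? j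
    ... | yes _ = state W t
    ... | no  _ = v

    state-last : ∀ {i j u v} (W : Walk w i u j v) → state W j ≡ v
    state-last []            = refl
    state-last (_▷_ {j} W _) with suc j ≤? j
    ... | yes sj≤j = contradiction sj≤j (n≮n j)
    ... | no  _    = refl

    state-▷ : ∀ {i j u y v t} (W : Walk w i u j y) (s : Step j (w j) y v) → t ≤ j → state (W ▷ s) t ≡ state W t
    state-▷ {j = j} {t = t} W s t≤j with t ≤? j
    ... | yes _   = refl
    ... | no  t≰j = contradiction t≤j t≰j

    state-first : ∀ {i j u v} (W : Walk w i u j v) → state W i ≡ u
    state-first []      = refl
    state-first (W ▷ s) = trans (state-▷ W s (Walk-≤ W)) (state-first W)

    state-step : ∀ {i j u v t} (W : Walk w i u j v) → i ≤ t → t < j → Step t (w t) (state W t) (state W (suc t))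
    state-step []            i≤t t<i  = contradiction i≤t (<⇒≱ t<i)
    state-step (_▷_ {j} W s) i≤t t<sj with m≤n⇒m<n∨m≡n (≤-pred t<sj)
    ... | inj₂ refl = subst₂ (Step j (w j)) (sym (trans (state-▷ W s ≤-refl) (state-last W))) (sym (state-last (W ▷ s))) s
    ... | inj₁ t<j  = subst₂ (Step _ _) (sym (state-▷ W s (<⇒≤ t<j))) (sym (state-▷ W s t<j)) (state-step W i≤t t<j)

  Walk-cong : ∀ {w w′ i j u v} → w ≡[ i , j ⟩ w′ → Walk w i u j v → Walk w′ i u j v
  Walk-cong same []      = []
  Walk-cong same (W ▷ s) =
    Walk-cong (λ t i≤t t<j → same t i≤t (m≤n⇒m≤1+n t<j)) W ▷ subst (λ b → Step _ b _ _) (same _ (Walk-≤ W) ≤-refl) s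

  Accepting : Fin D → (Fin D → Set) → ℕ → (ℕ → Bool) → Set
  Accepting start Final n w = ∃ λ v → Walk w 0 start n v × Final v

  walk? : (∀ t b u v → Dec (Step t b u v)) → ∀ w i u j v → Dec (Walk w i u j v)
  walk? step? w i u zero v =
    Dec.map (mk⇔ (λ { (refl , refl) → [] }) (λ { [] → refl , refl })) (i ≟ 0 ×-dec u Fin.≟ v)
  walk? step? w i u (suc j) v =
    Dec.map (mk⇔ join view) ((i ≟ suc j ×-dec u Fin.≟ v) ⊎-dec Fin.any? (λ y → walk? step? w i u j y ×-dec step? j (w j) y v))
    where
    join : (i ≡ suc j × u ≡ v) ⊎ ∃ (λ y → Walk w i u j y × Step j (w j) y v) → Walk w i u (suc j) v
    join (inj₁ (refl , refl)) = []
    join (inj₂ (_ , W , s))   = W ▷ s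
    view : Walk w i u (suc j) v → (i ≡ suc j × u ≡ v) ⊎ ∃ (λ y → Walk w i u j y × Step j (w j) y v)
    view []      = inj₁ (refl , refl)
    view (W ▷ s) = inj₂ (_ , W , s)


bit : Bool → ℕ
bit b = if b then 1 else 0

ones≡sum : ∀ {n} (ν : Input n) → ones ν ≡ sum (bit ∘ ν)
ones≡sum {zero}  ν = refl
ones≡sum {suc n} ν = cong (bit (ν Fin.zero) +_) (ones≡sum (ν ∘ Fin.suc))

ones-permute : ∀ {n} (π : Permutation′ n) (ν : Input n) → ones (λ i → ν (π ⟨$⟩ˡ i)) ≡ ones ν
ones-permute π ν = begin
  ones (λ i → ν (π ⟨$⟩ˡ i))                ≡⟨ ones≡sum (λ i → ν (π ⟨$⟩ˡ i)) ⟩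
  sum (λ i → bit (ν (π ⟨$⟩ˡ i)))           ≡⟨ sum-permute (λ i → bit (ν (π ⟨$⟩ˡ i))) π ⟩
  sum (λ i → bit (ν (π ⟨$⟩ˡ (π ⟨$⟩ʳ i))))  ≡⟨ sum-cong-≗ {x = λ i → bit (ν (π ⟨$⟩ˡ (π ⟨$⟩ʳ i)))} inverse ⟩
  sum (λ i → bit (ν i))                    ≡⟨ ones≡sum ν ⟨
  ones ν                                   ∎
  where
  open ≡-Reasoning
  inverse : ∀ i → bit (ν (π ⟨$⟩ˡ (π ⟨$⟩ʳ i))) ≡ bit (ν i)
  inverse i = cong (bit ∘ ν) (inverseˡ π)

ones-∨ : ∀ {n} (ν μ : Input n) → (∀ i → ν i ∧ μ i ≡ false) → ones (λ i → ν i ∨ μ i) ≡ ones ν + ones μ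
ones-∨ {zero}  ν μ disjoint = refl
ones-∨ {suc n} ν μ disjoint with ν Fin.zero | μ Fin.zero | disjoint Fin.zero
  | ones-∨ (ν ∘ Fin.suc) (μ ∘ Fin.suc) (disjoint ∘ Fin.suc)
... | true  | false | _ | ih = cong suc ih
... | false | true  | _ | ih = trans (cong suc ih) (sym (+-suc _ _))
... | false | false | _ | ih = ih

ones-false : ∀ {n} → ones {n} (λ _ → false) ≡ 0
ones-false {zero}  = refl
ones-false {suc n} = ones-false {n}

prefix : ∀ {n} → (ℕ → Bool) → Input n
prefix w i = w (toℕ i)

mark : ℕ → ℕ → Bool
mark i t = does (i ≟ t)

ones-mark : ∀ {n} t → t < n → ones {n} (prefix (mark t)) ≡ 1
ones-mark {suc n} zero    _         = cong suc (ones-false {n})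
ones-mark {suc n} (suc t) (s≤s t<n) = ones-mark t t<n

onesAt : (ℕ → ℕ) → ℕ → ℕ → Bool
onesAt x zero    t = false
onesAt x (suc c) t = onesAt x c t ∨ mark (x c) t

onesAt-false : ∀ {x c t} → (∀ a → a < c → x a ≢ t) → onesAt x c t ≡ false
onesAt-false {c = zero}  _    = refl
onesAt-false {x} {suc c} {t} away =
  cong₂ _∨_ (onesAt-false (λ a a<c → away a (m≤n⇒m≤1+n a<c))) (dec-false (x c ≟ t) (away c ≤-refl))

onesAt-at : ∀ {x c a} → a < c → onesAt x c (x a) ≡ true
onesAt-at {x} {suc c} {a} a<sc with m≤n⇒m<n∨m≡n (≤-pred a<sc)
... | inj₁ a<c  rewrite onesAt-at {x} a<c = refl
... | inj₂ refl = trans (cong (onesAt x c (x a) ∨_) (dec-true (x a ≟ x a) refl)) (∨-zeroʳ _)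

module Positions (x : ℕ → ℕ) (L : ℕ) (increasing : ∀ a → a < L → x a < x (suc a)) where

  x-≤ : ∀ {a b} → a ≤ b → b ≤ L → x a ≤ x b
  x-≤ {a} {b} a≤b b≤L with m≤n⇒m<n∨m≡n a≤b
  ... | inj₂ refl = ≤-refl
  x-≤ {a} {suc b} _ sb≤L | inj₁ (s≤s a≤b) = ≤-trans (x-≤ a≤b (<⇒≤ sb≤L)) (<⇒≤ (increasing b sb≤L))

  x-< : ∀ {a b} → a < b → b ≤ L → x a < x b
  x-< {a} {suc b} (s≤s a≤b) sb≤L = ≤-<-trans (x-≤ a≤b (<⇒≤ sb≤L)) (increasing b sb≤L)

  onesAt-before : ∀ {c t} → c ≤ L → t < x 0 → onesAt x (suc c) t ≡ false
  onesAt-before c≤L t<x₀ =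
    onesAt-false (λ a a≤c xa≡t → <⇒≱ t<x₀ (subst (x 0 ≤_) xa≡t (x-≤ z≤n (≤-trans (≤-pred a≤c) c≤L))))

  -- The bound on t is vacuous for the last position a = c, whose block reaches to infinity.
  onesAt-block : ∀ {a c t} → a ≤ c → c ≤ L → x a ≤ t → (a < c → t < x (suc a)) →
                 onesAt x (suc c) t ≡ mark (x a) t
  onesAt-block {a} {c} {t} a≤c c≤L xa≤t below with x a ≟ t
  ... | yes refl = trans (onesAt-at (s≤s a≤c)) (sym (dec-true (x a ≟ x a) refl))
  ... | no xa≢t  = trans (onesAt-false away) (sym (dec-false (x a ≟ t) xa≢t))
    where
    away : ∀ b → b < suc c → x b ≢ t
    away b b≤c xb≡t with <-cmp b a
    ... | tri< b<a _ _ = <⇒≱ (x-< b<a (≤-trans a≤c c≤L)) (subst (x a ≤_) (sym xb≡t) xa≤t)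
    ... | tri≈ _ refl _ = xa≢t xb≡t
    ... | tri> _ _ a<b =
      <⇒≱ (below (<-≤-trans a<b (≤-pred b≤c))) (subst (x (suc a) ≤_) xb≡t (x-≤ a<b (≤-trans (≤-pred b≤c) c≤L)))

  ones-onesAt : ∀ {n c} → x L < n → c ≤ suc L → ones {n} (prefix (onesAt x c)) ≡ c
  ones-onesAt {n} {zero} _ _ = ones-false {n}
  ones-onesAt {n} {suc c} xL<n (s≤s c≤L) = begin
    ones {n} (λ i → onesAt x c (toℕ i) ∨ mark (x c) (toℕ i))
      ≡⟨ ones-∨ {n} (prefix (onesAt x c)) (prefix (mark (x c))) disjoint ⟩
    ones {n} (prefix (onesAt x c)) + ones {n} (prefix (mark (x c)))
      ≡⟨ cong₂ _+_ (ones-onesAt xL<n (m≤n⇒m≤1+n c≤L)) xc-once ⟩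
    c + 1
      ≡⟨ +-comm c 1 ⟩
    suc c
      ∎
    where
    open ≡-Reasoning
    xc-once : ones {n} (prefix (mark (x c))) ≡ 1
    xc-once = ones-mark (x c) (≤-<-trans (x-≤ c≤L ≤-refl) xL<n)
    disjoint : ∀ i → onesAt x c (toℕ i) ∧ mark (x c) (toℕ i) ≡ false
    disjoint i with x c ≟ toℕ i
    ... | yes xc≡i =
      cong (_∧ mark (x c) (toℕ i)) (onesAt-false {x} {c} (λ a a<c xa≡i → <⇒≢ (x-< a<c c≤L) (trans xa≡i (sym xc≡i))))
    ... | no  xc≢i = trans (cong (onesAt x c (toℕ i) ∧_) (dec-false (x c ≟ toℕ i) xc≢i)) (∧-zeroʳ _)

module Blocks {D : ℕ} (Step : ℕ → Bool → Fin D → Fin D → Set)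
              (start : Fin D) (Final : Fin D → Set) (n : ℕ)
              (x : ℕ → ℕ) (L : ℕ) (increasing : ∀ a → a < L → x a < x (suc a)) (x-L<n : x L < n)
              (Seg : Fin D → Fin D → Set) (Tail : Fin D → Set)
              (seg  : ∀ a → a < L → ∀ u v → Walks.Walk Step (mark (x a)) (x a) u (x (suc a)) v ⇔ Seg u v)
              (tail : ∀ a → a < L → ∀ u → (∃ λ v → Walks.Walk Step (mark (x a)) (x a) u n v × Final v) ⇔ Tail u)
              where

  open Walks Step
  open Positions x L increasing

  Initial : Fin D → Set
  Initial = Walk (λ _ → false) 0 start (x 0)

  module _ {c} (c<L : c < L) where

    private
      c≤L = <⇒≤ c<L
      w = onesAt x (suc c)

      agree-before : w ≡[ 0 , x 0 ⟩ (λ _ → false)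
      agree-before t _ = onesAt-before c≤L

      agree-block : ∀ {a} → a < c → w ≡[ x a , x (suc a) ⟩ mark (x a)
      agree-block a<c t xa≤t t<xsa = onesAt-block (<⇒≤ a<c) c≤L xa≤t (λ _ → t<xsa)

      agree-last : w ≡[ x c , n ⟩ mark (x c)
      agree-last t xc≤t _ = onesAt-block ≤-refl c≤L xc≤t (λ c<c → contradiction c<c (n≮n c))

    walk-to⇔chain : ∀ {a y} → a ≤ c → Walk w 0 start (x a) y ⇔ ∃ λ y₀ → Initial y₀ × Chain Seg a y₀ y
    walk-to⇔chain {zero} _ =
      mk⇔ (λ W → _ , Walk-cong agree-before W , [])
          (λ { (_ , I , []) → Walk-cong (≡[,⟩-sym agree-before) I })
    walk-to⇔chain {suc a} sa≤c = mk⇔ forth back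
      where
      a<L = <-≤-trans sa≤c c≤L
      forth : ∀ {y} → Walk w 0 start (x (suc a)) y → ∃ λ y₀ → Initial y₀ × Chain Seg (suc a) y₀ y
      forth W
        with y , W₁ , W₂ ← split z≤n (<⇒≤ (increasing a a<L)) W
        with y₀ , I , ch ← to (walk-to⇔chain (<⇒≤ sa≤c)) W₁ =
        y₀ , I , ch ∷ʳ to (seg a a<L _ _) (Walk-cong (agree-block sa≤c) W₂)
      back : ∀ {y} → (∃ λ y₀ → Initial y₀ × Chain Seg (suc a) y₀ y) → Walk w 0 start (x (suc a)) y
      back (y₀ , I , ch) with y , ch′ , s ← unsnoc ch =
        from (walk-to⇔chain (<⇒≤ sa≤c)) (y₀ , I , ch′)
          ▷▷ Walk-cong (≡[,⟩-sym (agree-block sa≤c)) (from (seg a a<L _ _) s)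

    accepting⇔chain : Accepting start Final n w ⇔ ∃₂ λ y₀ y → Initial y₀ × Chain Seg c y₀ y × Tail y
    accepting⇔chain = mk⇔ forth back
      where
      forth : Accepting start Final n w → ∃₂ λ y₀ y → Initial y₀ × Chain Seg c y₀ y × Tail y
      forth (v , W , final)
        with y , W₁ , W₂ ← split z≤n (<⇒≤ (≤-<-trans (x-≤ c≤L ≤-refl) x-L<n)) W
        with y₀ , I , ch ← to (walk-to⇔chain ≤-refl) W₁ =
        y₀ , y , I , ch , to (tail c c<L y) (v , Walk-cong agree-last W₂ , final)
      back : (∃₂ λ y₀ y → Initial y₀ × Chain Seg c y₀ y × Tail y) → Accepting start Final n w
      back (y₀ , y , I , ch , t) with v , W , final ← from (tail c c<L y) t =
        v , from (walk-to⇔chain ≤-refl) (y₀ , I , ch) ▷▷ Walk-cong (≡[,⟩-sym agree-last) W , final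

module Embedding {n} (B : NOBDD n) {D} (narrow : ∀ l → size B l ≤ D) where

  embed : ∀ l → Fin (size B l) → Fin D
  embed l X = inject≤ X (narrow l)

  Step : ℕ → Bool → Fin D → Fin D → Set
  Step t b u v = ∃ λ j → toℕ j ≡ t × ∃₂ λ X Y →
                 embed (inject₁ j) X ≡ u × embed (suc j) Y ≡ v × edge B j X b Y ≡ true

  step? : ∀ t b u v → Dec (Step t b u v)
  step? t b u v = Fin.any? λ j → toℕ j ≟ t ×-dec Fin.any? λ X → Fin.any? λ Y →
                  embed _ X Fin.≟ u ×-dec embed _ Y Fin.≟ v ×-dec edge B j X b Y Bool.≟ true

  Final : Fin D → Set
  Final v = ∃ λ X → embed (fromℕ n) X ≡ v × accepting B X ≡ true

  root : Fin (size B zero)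
  root = subst Fin (sym (source B)) zero

  start : Fin D
  start = embed zero root

  -- Step t of B reads the letter w t.
  input : (ℕ → Bool) → Input n
  input w i = w (toℕ (order B ⟨$⟩ˡ i))

  final? : ∀ v → Dec (Final v)
  final? v = Fin.any? λ X → embed _ X Fin.≟ v ×-dec accepting B X Bool.≟ true

  open Walks Step

  private
    root-unique : (X : Fin (size B zero)) → X ≡ root
    root-unique X = unique (source B) X root
      where
      unique : ∀ {m} → m ≡ 1 → (X Y : Fin m) → X ≡ Y
      unique refl zero zero = refl

    input-letter : ∀ w j → input w (order B ⟨$⟩ʳ j) ≡ w (toℕ j)
    input-letter w j = cong (w ∘′ toℕ) (inverseˡ (order B))

    step-at : ∀ j {b u v} → Step (toℕ j) b u v →
              ∃₂ λ X Y → embed (inject₁ j) X ≡ u × embed (suc j) Y ≡ v × edge B j X b Y ≡ true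
    step-at j (_ , same , step) with refl ← Fin.toℕ-injective same = step

  path→walk : ∀ w → Accepts B (input w) → Accepting start Final n w
  path→walk w (p , path , accept) = embed _ (p (fromℕ n)) , walk-to-end , p (fromℕ n) , refl , accept
    where
    walk-to : ∀ l → Walk w 0 start (toℕ l) (embed l (p l))
    walk-to = <-weakInduction (λ l → Walk w 0 start (toℕ l) (embed l (p l)))
      (subst (λ X → Walk w 0 start 0 (embed zero X)) (sym (root-unique (p zero))) [])
      (λ j W → subst (λ t → Walk w 0 start t (embed _ (p (inject₁ j)))) (Fin.toℕ-inject₁ j) W
               ▷ (j , refl , _ , _ , refl , refl , subst (λ b → edge B j _ b _ ≡ true) (input-letter w j) (path j)))

    walk-to-end : Walk w 0 start n (embed _ (p (fromℕ n)))
    walk-to-end = subst (λ t → Walk w 0 start t (embed _ (p (fromℕ n)))) (Fin.toℕ-fromℕ n) (walk-to (fromℕ n))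

  walk→path : ∀ w → Accepting start Final n w → Accepts B (input w)
  walk→path w (v , W , X , X↦v , accept) = p , path , subst (λ X → accepting B X ≡ true) (sym p-last) accept
    where
    edge-at : ∀ j → ∃₂ λ X Y → embed (inject₁ j) X ≡ state W (toℕ j) × embed (suc j) Y ≡ state W (suc (toℕ j)) ×
                                edge B j X (w (toℕ j)) Y ≡ true
    edge-at j = step-at j (state-step W z≤n (Fin.toℕ<n j))

    p : (l : Fin (suc n)) → Fin (size B l)
    p zero    = root
    p (suc j) = proj₁ (proj₂ (edge-at j))

    p↦state : ∀ l → embed l (p l) ≡ state W (toℕ l)
    p↦state zero    = sym (state-first W)
    p↦state (suc j) = proj₁ (proj₂ (proj₂ (proj₂ (edge-at j))))

    p-unique : ∀ {l} {X : Fin (size B l)} → embed l X ≡ state W (toℕ l) → p l ≡ X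
    p-unique {l} X↦ = Fin.inject≤-injective _ _ _ _ (trans (p↦state l) (sym X↦))

    path : IsPath B (input w) p
    path j = let (X , Y , X↦ , _ , e) = edge-at j in
      subst₂ (λ X b → edge B j X b (p (suc j)) ≡ true)
        (sym (p-unique (trans X↦ (cong (state W) (sym (Fin.toℕ-inject₁ j))))))
        (sym (input-letter w j)) e

    p-last : p (fromℕ n) ≡ X
    p-last = p-unique (trans X↦v (trans (sym (state-last W)) (cong (state W) (sym (Fin.toℕ-fromℕ n)))))

  accepts⇔accepting : ∀ w → Accepts B (input w) ⇔ Accepting start Final n w
  accepts⇔accepting w = mk⇔ (path→walk w) (walk→path w)


bools : List Bool
bools = true ∷ false ∷ []

bools-complete : ∀ b → b ∈ bools
bools-complete true  = here refl
bools-complete false = there (here refl)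

vectors : ∀ {A : Set} → List A → ∀ m → List (Vec A m)
vectors as zero    = [] ∷ []
vectors as (suc m) = map (uncurry _∷_) (cartesianProduct as (vectors as m))

vectors-complete : ∀ {A : Set} {as : List A} → (∀ a → a ∈ as) → ∀ {m} (v : Vec A m) → v ∈ vectors as m
vectors-complete complete []       = here refl
vectors-complete complete (a ∷ v) =
  ∈-map⁺ (uncurry _∷_) (∈-cartesianProduct⁺ (complete a) (vectors-complete complete v))

decide : ∀ {m} {P : Fin m → Set} → (∀ u → Dec (P u)) → Vec Bool m
decide P? = tabulate (λ u → ⌊ P? u ⌋)

decide-correct : ∀ {m} {P : Fin m → Set} (P? : ∀ u → Dec (P u)) u → P u ⇔ T (lookup (decide P?) u)
decide-correct {P = P} P? u = subst (λ b → P u ⇔ T b) (sym (Vec.lookup∘tabulate _ u)) (mk⇔ fromWitness toWitness)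

decide₂ : ∀ {k m} {P : Fin k → Fin m → Set} → (∀ u v → Dec (P u v)) → Vec (Vec Bool m) k
decide₂ P? = tabulate (λ u → decide (P? u))

decide₂-correct : ∀ {k m} {P : Fin k → Fin m → Set} (P? : ∀ u v → Dec (P u v)) u v →
                  P u v ⇔ T (lookup (lookup (decide₂ P?) u) v)
decide₂-correct {P = P} P? u v =
  subst (λ r → P u v ⇔ T (lookup r v)) (sym (Vec.lookup∘tabulate (λ u → decide (P? u)) u)) (decide-correct (P? u) v)

Colour : ℕ → Set
Colour D = Vec (Vec Bool D) D × Vec Bool D

_≟ᶜ_ : ∀ {D} → DecidableEquality (Colour D)
_≟ᶜ_ = Product.≡-dec (Vec.≡-dec (Vec.≡-dec Bool._≟_)) (Vec.≡-dec Bool._≟_)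

colours : ∀ D → List (Colour D)
colours D = cartesianProduct (vectors (vectors bools D) D) (vectors bools D)

colours-complete : ∀ {D} (c : Colour D) → c ∈ colours D
colours-complete (M , t) =
  ∈-cartesianProduct⁺ (vectors-complete (vectors-complete bools-complete) M) (vectors-complete bools-complete t)

module NarrowNOBDD {n} (B : NOBDD n) {D} (narrow : ∀ l → size B l ≤ D) where

  open Embedding B narrow
  open Walks Step

  tail? : ∀ i u → Dec (∃ λ v → Walk (mark i) i u n v × Final v)
  tail? i u = Fin.any? λ v → walk? step? (mark i) i u n v ×-dec final? v

  colour : ℕ → ℕ → Colour D
  colour i j = decide₂ (λ u v → walk? step? (mark i) i u j v) , decide (tail? i)

  module Uniform (x : ℕ → ℕ) (L : ℕ) (E : Colour D)
                 (uniform : ∀ a → a < L → x a < x (suc a) × colour (x a) (x (suc a)) ≡ E) (x-L<n : x L < n) where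

    increasing : ∀ a → a < L → x a < x (suc a)
    increasing a a<L = proj₁ (uniform a a<L)

    word : ℕ → Input n
    word c = input (onesAt x c)

    ones-word : ∀ c → c ≤ L → ones (word c) ≡ c
    ones-word c c≤L = trans (ones-permute (order B) (prefix (onesAt x c)))
                            (Positions.ones-onesAt x L increasing x-L<n (m≤n⇒m≤1+n c≤L))

    Seg : Fin D → Fin D → Set
    Seg u v = T (lookup (lookup (proj₁ E) u) v)

    Tail : Fin D → Set
    Tail u = T (lookup (proj₂ E) u)

    seg : ∀ a → a < L → ∀ u v → Walk (mark (x a)) (x a) u (x (suc a)) v ⇔ Seg u v
    seg a a<L u v = subst (λ M → Walk (mark (x a)) (x a) u (x (suc a)) v ⇔ T (lookup (lookup M u) v))
                          (cong proj₁ (proj₂ (uniform a a<L))) (decide₂-correct _ u v)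

    tail : ∀ a → a < L → ∀ u → (∃ λ v → Walk (mark (x a)) (x a) u n v × Final v) ⇔ Tail u
    tail a a<L u = subst (λ t → (∃ λ v → Walk (mark (x a)) (x a) u n v × Final v) ⇔ T (lookup t u))
                         (cong proj₂ (proj₂ (uniform a a<L))) (decide-correct _ u)

    open Blocks Step start Final n x L increasing x-L<n Seg Tail seg tail

    pump-word : ∀ c → D ≤ c → c < L → Accepts B (word (suc c)) →
                ∃ λ ℓ → 0 < ℓ × ℓ ≤ D × ∀ M → c + M * ℓ < L → Accepts B (word (suc (c + M * ℓ)))
    pump-word c D≤c c<L accepted
      with y₀ , y , I , chain , t ← to (accepting⇔chain c<L) (to (accepts⇔accepting _) accepted)
      with ℓ , 0<ℓ , ℓ≤D , pumped ← pump D≤c chain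
      = ℓ , 0<ℓ , ℓ≤D , λ M c+Mℓ<L →
          from (accepts⇔accepting _) (from (accepting⇔chain c+Mℓ<L) (y₀ , y , I , pumped M , t))

Pumpable : ∀ {n} → NOBDD n → ℕ → ℕ → Set
Pumpable {n} B D L = ∃ λ (word : ℕ → Input n) → (∀ c → c ≤ L → ones (word c) ≡ c) ×
  (∀ c → D ≤ c → c < L → Accepts B (word (suc c)) →
     ∃ λ ℓ → 0 < ℓ × ℓ ≤ D × ∀ M → c + M * ℓ < L → Accepts B (word (suc (c + M * ℓ))))

narrow-pumpable : ∀ D L → ∃ λ N → ∀ {n} → N < n → (B : NOBDD n) → (∀ l → size B l ≤ D) → Pumpable B D L
narrow-pumpable D L = bound (suc (length (colours D) * L)) , pumpable
  where
  open Ramsey _≟ᶜ_ (colours D) colours-complete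
  pumpable : ∀ {n} → bound (suc (length (colours D) * L)) < n → (B : NOBDD n) → (∀ l → size B l ≤ D) → Pumpable B D L
  pumpable {n} N<n B narrow
    with x , E , uniform , x-L<n ← monochromatic-path (NarrowNOBDD.colour B narrow) L n N<n
    = word , ones-word , pump-word
    where open NarrowNOBDD.Uniform B narrow x L E uniform x-L<n

mod-multiple : ∀ k q → mod2^k+1 k (q * 2 ^ suc k) ≡ 0
mod-multiple k q = m*n%n≡0 q (2 ^ suc k) {{m^n≢0 2 (suc k)}}

mod-half : ∀ k q → mod2^k+1 k (2 ^ k + q * 2 ^ suc k) ≡ 2 ^ k
mod-half k q = trans ([m+kn]%n≡m%n (2 ^ k) q (2 ^ suc k) {{m^n≢0 2 (suc k)}})
                     (m<n⇒m%n≡m {{m^n≢0 2 (suc k)}} (^-monoʳ-< 2 (s≤s (s≤s z≤n)) (n<1+n k)))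

PartialMOD-accepts : ∀ k {n} (ν : Input n) q → ones ν ≡ q * 2 ^ suc k → PartialMOD k n ν ≡ just true
PartialMOD-accepts k ν q count rewrite count | mod-multiple k q = refl

PartialMOD-rejects : ∀ k {n} (ν : Input n) q → ones ν ≡ 2 ^ k + q * 2 ^ suc k → PartialMOD k n ν ≡ just false
PartialMOD-rejects k ν q count
  rewrite count | mod-half k q
        | isYes≗does (2 ^ k ≟ 0) | dec-false (2 ^ k ≟ 0) (≢-nonZero⁻¹ (2 ^ k) {{m^n≢0 2 k}})
        | isYes≗does (2 ^ k ≟ 2 ^ k) | dec-true (2 ^ k ≟ 2 ^ k) refl = refl

width-dichotomy : ∀ {n} (B : NOBDD n) w → WidthAtLeast B w ⊎ (∀ l → size B l < w)
width-dichotomy B w with Fin.any? (λ l → w ≤? size B l)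
... | yes wide = inj₁ wide
... | no  ¬wide = inj₂ (λ l → ≰⇒> (λ w≤l → ¬wide (l , w≤l)))

pumpable-¬computes : ∀ k {n D} (B : NOBDD n) → suc D ≡ 2 ^ suc k →
                     Pumpable B D (suc (D + 2 ^ suc k * D)) → ¬ Computes B (PartialMOD k n)
pumpable-¬computes k {n} {D} B 1+D≡K (word , ones-word , pump-word) computes =
  rejected (pump-word D ≤-refl (s≤s (m≤m+n D _)) accepted)
  where
  K = 2 ^ suc k

  accepted : Accepts B (word (suc D))
  accepted = proj₁ (computes (word (suc D)))
    (PartialMOD-accepts k (word (suc D)) 1 (trans (ones-word (suc D) (s≤s (m≤m+n D _))) (trans 1+D≡K (sym (*-identityˡ K)))))

  count : ∀ M ℓ q → M * ℓ ≡ 2 ^ k + q * K → M * ℓ ≤ K * D → ones (word (suc (D + M * ℓ))) ≡ 2 ^ k + suc q * K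
  count M ℓ q Mℓ≡ Mℓ≤ = begin
    ones {n} (word (suc (D + M * ℓ)))  ≡⟨ ones-word _ (s≤s (+-monoʳ-≤ D Mℓ≤)) ⟩
    suc D + M * ℓ                      ≡⟨ cong₂ _+_ 1+D≡K Mℓ≡ ⟩
    K + (2 ^ k + q * K)                ≡⟨ shuffle K (2 ^ k) q ⟩
    2 ^ k + suc q * K                  ∎
    where
    open ≡-Reasoning
    shuffle : ∀ K h q → K + (h + q * K) ≡ h + (1 + q) * K
    shuffle = solve-∀

  rejected : ¬ ∃ λ ℓ → 0 < ℓ × ℓ ≤ D × ∀ M → D + M * ℓ < suc (D + K * D) → Accepts B (word (suc (D + M * ℓ)))
  rejected (ℓ , 0<ℓ , ℓ≤D , pumped) with M , q , M≤K , Mℓ≡ ← multiple≡2^k k 0<ℓ (subst (ℓ <_) 1+D≡K (s≤s ℓ≤D)) =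
    proj₂ (computes ν) (PartialMOD-rejects k ν (suc q) (count M ℓ q Mℓ≡ Mℓ≤)) (pumped M (s≤s (+-monoʳ-≤ D Mℓ≤)))
    where
    ν = word (suc (D + M * ℓ))
    Mℓ≤ : M * ℓ ≤ K * D
    Mℓ≤ = *-mono-≤ M≤K ℓ≤D

theorem3 : (k : ℕ) → (m : ℕ) → ∃ λ (n : ℕ) → m ≤ n ×
             ((B : NOBDD n) → Computes B (PartialMOD k n) → WidthAtLeast B (2 ^ suc k))
theorem3 k m = suc (N + m) , m≤n⇒m≤1+n (m≤n+m m N) , wide
  where
  K = 2 ^ suc k
  D = pred K
  L = suc (D + K * D)
  N = proj₁ (narrow-pumpable D L)

  1+D≡K : suc D ≡ K
  1+D≡K = suc-pred K {{m^n≢0 2 (suc k)}}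

  wide : (B : NOBDD (suc (N + m))) → Computes B (PartialMOD k (suc (N + m))) → WidthAtLeast B K
  wide B computes with width-dichotomy B K
  ... | inj₁ K≤level = K≤level
  ... | inj₂ levels<K = contradiction computes (pumpable-¬computes k B 1+D≡K (proj₂ (narrow-pumpable D L) N<n B narrow))
    where
    N<n : N < suc (N + m)
    N<n = s≤s (m≤m+n N m)
    narrow : ∀ l → size B l ≤ D
    narrow l = ≤-pred (subst (size B l <_) (sym 1+D≡K) (levels<K l))
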